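{- For all type environments $\Gamma$ and systems $M\triangleright P$, $M'\triangleright P'$, $M''\triangleright P''$: if $\Gamma\models M\triangleright P\sqsubseteq_{bis} M'\triangleright P'$ and $\Gamma\models M'\triangleright P'\sqsubseteq_{bis}M''\triangleright P''$, then $\Gamma\models M\triangleright P\sqsubseteq_{bis}M''\triangleright P''$.
   Context: Calculus. Fix disjoint countably infinite sets $\mathcal C$ of channel names ($c,d$) and $\mathcal V$ of variables ($x,y,z,w$); identifiers $u,v$ range over $\mathcal C\cup\mathcal V$. Processes: $P,Q::= u!\langle\vec v\rangle.P \mid u?(\vec x).P\mid \mathbf 0\mid \mathsf{if}\ u=v\ \mathsf{then}\ P\ \mathsf{else}\ Q\mid \mathsf{rec}\,w.P\mid w\mid P\parallel Q\mid \mathsf{alloc}\,x.P\mid \mathsf{free}\,u.P$; input binds $\vec x$, $\mathsf{rec}$ binds $w$, $\mathsf{alloc}$ binds $x$ (no name restriction). A resource environment $M$ is a set of (allocated) channels, infinitely many channels being unallocated; $M,c$ denotes $M\cup\{c\}$ and presupposes $c\notin M$. A system $M\triangleright P$ pairs a resource environment with a closed process. Types. Attributes $a::=\omega\mid 1\mid \bullet i$ ($i\in\mathbb N$; $\bullet$ abbreviates $\bullet 0$). Types $T::=U\mid \mathsf{proc}$, $U::=[\vec U]^a\mid \mu X.U\mid X$, closed contractive, up to equi-recursive equality $\sim$. Type environments $\Gamma$ are finite multisets of assumptions $u:T$. Splitting: $[\vec T]^\omega=[\vec T]^\omega\circ[\vec T]^\omega$; $\mathsf{proc}=\mathsf{proc}\circ\mathsf{proc}$;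 $[\vec T]^{\bullet i}=[\vec T]^{1}\circ[\vec T]^{\bullet(i+1)}$. Subtyping generated by $\bullet i\preceq\bullet(i+1)$, $\bullet i\preceq\omega$, $\omega\preceq 1$, lifted to $[\vec T]^{a_1}\preceq[\vec T]^{a_2}$. The relation $\prec$ on environments is the least reflexive transitive relation with: $\Gamma,u:T\prec\Gamma,u:T_1,u:T_2$ and its converse when $T=T_1\circ T_2$; $\Gamma,u:T_1\prec\Gamma,u:T_2$ when $T_1\sim T_2$ or $T_1\preceq T_2$; $\Gamma,u:T\prec\Gamma$; $\Gamma,u:[\vec T_1]^\bullet\prec\Gamma,u:[\vec T_2]^\bullet$. Decrement $(u:[\vec T]^a-1)$: empty if $a=1$; $u:[\vec T]^\omega$ if $a=\omega$; $u:[\vec T]^{\bullet i}$ if $a=\bullet(i+1)$; undefined if $a=\bullet$. Typing $\Gamma\vdash P$ is given by the rules: $\Gamma,(u:[\vec T]^a-1)\vdash P\Rightarrow\Gamma,u:[\vec T]^a,\vec v:\vec T\vdash u!\langle\vec v\rangle.P$; $\Gamma,(u:[\vec T]^a-1),\vec x:\vec T\vdash P\Rightarrow\Gamma,u:[\vec T]^a\vdash u?(\vec x).P$; $\Gamma_1\vdash P,\Gamma_2\vdash Q\Rightarrow\Gamma_1,\Gamma_2\vdash P\parallel Q$; $u,v\in\mathrm{dom}(\Gamma)$, $\Gamma\vdash P,\Gamma\vdash Q\Rightarrow\Gamma\vdash\mathsf{if}\ u=v\ \mathsf{then}\ P\ \mathsf{else}\ Q$; $\Gamma^\omega,w:\mathsf{proc}\vdash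 P\Rightarrow\Gamma^\omega\vdash\mathsf{rec}\,w.P$ ($\Gamma^\omega$ only unrestricted assumptions); $w:\mathsf{proc}\vdash w$; $\Gamma\vdash P\Rightarrow\Gamma,u:[\vec T]^\bullet\vdash\mathsf{free}\,u.P$; $\Gamma,x:[\vec T]^\bullet\vdash P\Rightarrow\Gamma\vdash\mathsf{alloc}\,x.P$; $\emptyset\vdash\mathbf 0$; $\Gamma'\vdash P,\Gamma\prec\Gamma'\Rightarrow\Gamma\vdash P$. $\Gamma$ is consistent if some $\Gamma'$ with each identifier occurring at most once satisfies $\Gamma'\prec\Gamma$. $\Gamma\vdash M\triangleright P$ iff $\Gamma\vdash P$, $\mathrm{dom}(\Gamma)\subseteq M$, $\Gamma$ consistent. A configuration $\Gamma\triangleleft M\triangleright P$: $\mathrm{dom}(\Gamma)\subseteq M$ and some $\Delta$ has $(\Gamma,\Delta)$ consistent and $\Delta\vdash M\triangleright P$. LTS. Pre-transitions $\Gamma\triangleleft M\triangleright P\xrightarrow{\mu}{}^{\mathrm{pre}}_k\Gamma'\triangleleft M'\triangleright P'$ ($\mu::=c!\vec d\mid c?\vec d\mid\tau\mid\mathsf{alloc}\mid\mathsf{free}\,c\mid\mathsf{env}$, $k\in\mathbb Z$) are the least relation with: $\Gamma,c:[\vec T]^a\triangleleft M\triangleright c!\langle\vec d\rangle.P\xrightarrow{c!\vec d}_0\Gamma,(c:[\vec T]^a-1),\vec d:\vec T\triangleleft M\triangleright P$; $\Gamma,c:[\vec T]^a,\vec d:\vec T\triangleleft M\triangleright c?(\vec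 x).P\xrightarrow{c?\vec d}_0\Gamma,(c:[\vec T]^a-1)\triangleleft M\triangleright P\{\vec d/\vec x\}$; if $\Gamma_1\triangleleft M\triangleright P\xrightarrow{c!\vec d}_0\Gamma_1'\triangleleft M\triangleright P'$ and $\Gamma_2\triangleleft M\triangleright Q\xrightarrow{c?\vec d}_0\Gamma_2'\triangleleft M\triangleright Q'$ then for any $\Gamma$, $\Gamma\triangleleft M\triangleright P\parallel Q\xrightarrow{\tau}_0\Gamma\triangleleft M\triangleright P'\parallel Q'$ (and symmetrically for $Q\parallel P$); parallel closure on either side preserving $\mu,k$ and the resulting environment; $\Gamma\triangleleft M\triangleright P\xrightarrow{\mathsf{env}}_0\Gamma'\triangleleft M\triangleright P$ when $\Gamma\prec\Gamma'$; cost-0 $\tau$-steps for recursion unfolding and for $\mathsf{if}\ c=c$ (to then-branch, $c\in M$) and $\mathsf{if}\ c=d$, $c\neq d$ (to else-branch, $c,d\in M$); $\Gamma\triangleleft M\triangleright\mathsf{alloc}\,x.P\xrightarrow{\tau}_{+1}\Gamma\triangleleft M,c\triangleright P\{c/x\}$; $\Gamma\triangleleft M\triangleright P\xrightarrow{\mathsf{alloc}}_{+1}\Gamma,c:[\vec T]^\bullet\triangleleft M,c\triangleright P$; $\Gamma\triangleleft M,c\triangleright\mathsf{free}\,c.P\xrightarrow{\tau}_{ -1}\Gamma\triangleleft M\triangleright P$; $\Gamma,c:[\vec T]^\bullet\triangleleft M,c\triangleright P\xrightarrow{\mathsf{free}\,c}_{ -1}\Gamma\triangleleft M\triangleright P$.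 A renaming modulo $\Gamma$, $\sigma_\Gamma$, is a bijection on channel names fixing every channel in $\mathrm{dom}(\Gamma)$. Transitions: $\Gamma\triangleleft M\triangleright P\xrightarrow{\mu}_kX$ iff $\Gamma\triangleleft(M\triangleright P)\sigma_\Gamma\xrightarrow{\mu}{}^{\mathrm{pre}}_kX$ for some renaming $\sigma_\Gamma$ modulo $\Gamma$. Weak transitions $\xRightarrow{\mu}_k$: zero or more $\tau$-transitions, one $\mu$-transition, zero or more $\tau$-transitions, $k$ the sum of costs; $\hat\mu=\mu$ if $\mu\neq\tau$, and $\xRightarrow{\hat\tau}_k$ denotes zero or more $\tau$-transitions with total cost $k$. Bisimulation. An amortised typed relation $\mathcal R$ is a set of quadruples $(\Gamma,n,S,T)$, $n\in\mathbb N$, $S,T$ systems with $\Gamma\triangleleft S$, $\Gamma\triangleleft T$ configurations; write $\Gamma\models S\,\mathcal R^n\,T$. It is an amortised typed bisimulation if whenever $\Gamma\models(M\triangleright P)\mathcal R^n(N\triangleright Q)$: every $\Gamma\triangleleft M\triangleright P\xrightarrow{\mu}_k\Gamma'\triangleleft M'\triangleright P'$ has some $\Gamma\triangleleft N\triangleright Q\xRightarrow{\hat\mu}_l\Gamma'\triangleleft N'\triangleright Q'$ with $\Gamma'\models(M'\triangleright P')\mathcal R^{n+l-k}(N'\triangleright Q')$; and every $\Gamma\triangleleft N\triangleright Q\xrightarrow{\mu}_l\Gamma'\triangleleft N'\triangleright Q'$ has some $\Gamma\triangleleft M\triangleright P\xRightarrow{\hat\mu}_k\Gamma'\triangleleft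 M'\triangleright P'$ with $\Gamma'\models(M'\triangleright P')\mathcal R^{n+l-k}(N'\triangleright Q')$ (credits must remain in $\mathbb N$). $\Gamma\models S\sqsubseteq^n_{bis}T$ iff some amortised typed bisimulation contains $(\Gamma,n,S,T)$; $\Gamma\models S\sqsubseteq_{bis}T$ iff $\Gamma\models S\sqsubseteq^n_{bis}T$ for some $n\in\mathbb N$. -}

module Defs where

open import Data.Nat as ℕ using (ℕ; zero; suc; _≤_; _<ᵇ_; _≡ᵇ_)
open import Data.Integer as ℤ using (ℤ; +_; -[1+_])
open import Data.Bool using (Bool; true; false; _∧_; _∨_; not; if_then_else_; T)
open import Data.Unit using (⊤; tt)
open import Data.Empty using (⊥)
open import Data.List using (List; []; _∷_; _++_; map; zip; length)
open import Data.List.Relation.Unary.All using (All)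
open import Data.List.Relation.Unary.Unique.Propositional using (Unique)
open import Data.List.Relation.Binary.Pointwise using (Pointwise)
open import Data.List.Relation.Binary.Permutation.Propositional using (_↭_)
open import Data.List.Membership.Propositional using (_∈_)
open import Data.Product using (Σ; ∃; ∃-syntax; _×_; _,_; proj₁; proj₂)
open import Data.Sum using (_⊎_)
open import Relation.Binary.PropositionalEquality using (_≡_; _≢_)
open import Relation.Binary.Construct.Closure.ReflexiveTransitive using (Star)
open import Relation.Nullary using (¬_)
open import Function.Bundles using (_↔_; Inverse)

Chan : Set
Chan = ℕ

Var : Set
Var = ℕ

data Ident : Set where
  ch : Chan → Ident
  vr : Var → Ident

-- Processes (named binders; no name restriction)

data Proc : Set where
  send  : Ident → List Ident → Proc → Proc
  recv  : Ident → List Var → Proc → Proc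
  nil   : Proc
  ifte  : Ident → Ident → Proc → Proc → Proc
  rec   : Var → Proc → Proc
  pvar  : Var → Proc
  par   : Proc → Proc → Proc
  alloc : Var → Proc → Proc
  free  : Ident → Proc → Proc

data IdentIn (bs : List Var) : Ident → Set where
  chI : ∀ c → IdentIn bs (ch c)
  vrI : ∀ {x} → x ∈ bs → IdentIn bs (vr x)

data ClosedIn (bs : List Var) : Proc → Set where
  c-send  : ∀ {u vs P} → IdentIn bs u → All (IdentIn bs) vs → ClosedIn bs P → ClosedIn bs (send u vs P)
  c-recv  : ∀ {u xs P} → IdentIn bs u → ClosedIn (xs ++ bs) P → ClosedIn bs (recv u xs P)
  c-nil   : ClosedIn bs nil
  c-if    : ∀ {u v P Q} → IdentIn bs u → IdentIn bs v → ClosedIn bs P → ClosedIn bs Q → ClosedIn bs (ifte u v P Q)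
  c-rec   : ∀ {w P} → ClosedIn (w ∷ bs) P → ClosedIn bs (rec w P)
  c-pvar  : ∀ {w} → w ∈ bs → ClosedIn bs (pvar w)
  c-par   : ∀ {P Q} → ClosedIn bs P → ClosedIn bs Q → ClosedIn bs (par P Q)
  c-alloc : ∀ {x P} → ClosedIn (x ∷ bs) P → ClosedIn bs (alloc x P)
  c-free  : ∀ {u P} → IdentIn bs u → ClosedIn bs P → ClosedIn bs (free u P)

Closed : Proc → Set
Closed = ClosedIn []

substI : Var → Chan → Ident → Ident
substI x c (ch d) = ch d
substI x c (vr y) = if y ≡ᵇ x then ch c else vr y

memb : Var → List Var → Bool
memb x []       = false
memb x (y ∷ ys) = (x ≡ᵇ y) ∨ memb x ys

substP : Var → Chan → Proc → Proc
substP x c (send u vs P)   = send (substI x c u) (map (substI x c) vs) (substP x c P)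
substP x c (recv u xs P)   = recv (substI x c u) xs (if memb x xs then P else substP x c P)
substP x c nil             = nil
substP x c (ifte u v P Q)  = ifte (substI x c u) (substI x c v) (substP x c P) (substP x c Q)
substP x c (rec w P)       = rec w (if w ≡ᵇ x then P else substP x c P)
substP x c (pvar w)        = pvar w
substP x c (par P Q)       = par (substP x c P) (substP x c Q)
substP x c (alloc y P)     = alloc y (if y ≡ᵇ x then P else substP x c P)
substP x c (free u P)      = free (substI x c u) (substP x c P)

-- P{d⃗/x⃗} (channels are closed, so sequential = simultaneous substitution)
substs : List Var → List Chan → Proc → Proc
substs (x ∷ xs) (d ∷ ds) P = substs xs ds (substP x d P)
substs _        _        P = P

-- substitution of a (closed) process for a process variable: P{R/w}
psubst : Var → Proc → Proc → Proc
psubst w R (send u vs P)   = send u vs (psubst w R P)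
psubst w R (recv u xs P)   = recv u xs (if memb w xs then P else psubst w R P)
psubst w R nil             = nil
psubst w R (ifte u v P Q)  = ifte u v (psubst w R P) (psubst w R Q)
psubst w R (rec v P)       = rec v (if v ≡ᵇ w then P else psubst w R P)
psubst w R (pvar v)        = if v ≡ᵇ w then R else pvar v
psubst w R (par P Q)       = par (psubst w R P) (psubst w R Q)
psubst w R (alloc y P)     = alloc y (if y ≡ᵇ w then P else psubst w R P)
psubst w R (free u P)      = free u (psubst w R P)

renI : (Chan → Chan) → Ident → Ident
renI f (ch c) = ch (f c)
renI f (vr x) = vr x

renP : (Chan → Chan) → Proc → Proc
renP f (send u vs P)   = send (renI f u) (map (renI f) vs) (renP f P)
renP f (recv u xs P)   = recv (renI f u) xs (renP f P)
renP f nil             = nil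
renP f (ifte u v P Q)  = ifte (renI f u) (renI f v) (renP f P) (renP f Q)
renP f (rec w P)       = rec w (renP f P)
renP f (pvar w)        = pvar w
renP f (par P Q)       = par (renP f P) (renP f Q)
renP f (alloc x P)     = alloc x (renP f P)
renP f (free u P)      = free (renI f u) (renP f P)

-- a resource environment is (the characteristic function of) a set of channels
RM : Set
RM = Chan → Bool

-- M , c   (presupposes c ∉ M)
addC : RM → Chan → RM
addC M c x = (x ≡ᵇ c) ∨ M x

remC : RM → Chan → RM
remC M c x = not (x ≡ᵇ c) ∧ M x

InfUnalloc : RM → Set
InfUnalloc M = ∀ n → ∃[ c ] (n ≤ c × M c ≡ false)

Sys : Set
Sys = RM × Proc

WfSys : Sys → Set
WfSys (M , P) = InfUnalloc M × Closed P

data Attr : Set where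
  ω   : Attr
  one : Attr
  bul : ℕ → Attr    -- •i ;  • = bul 0

-- raw (pre)types U, de Bruijn type variables
data Ty : Set where
  chT  : Attr → List Ty → Ty
  mu   : Ty → Ty
  tvar : ℕ → Ty

unguarded : ℕ → Ty → Bool
unguarded k (chT a Us) = false
unguarded k (mu B)     = unguarded (suc k) B
unguarded k (tvar j)   = j ≡ᵇ k

-- closed (at depth k) and contractive
mutual
  ok : ℕ → Ty → Bool
  ok k (chT a Us) = okL k Us
  ok k (mu B)     = not (unguarded 0 B) ∧ ok (suc k) B
  ok k (tvar j)   = j <ᵇ k

  okL : ℕ → List Ty → Bool
  okL k []       = true
  okL k (U ∷ Us) = ok k U ∧ okL k Us

-- substitution of a closed type for variable k
mutual
  tsub : ℕ → Ty → Ty → Ty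
  tsub k C (chT a Us) = chT a (tsubL k C Us)
  tsub k C (mu B)     = mu (tsub (suc k) C B)
  tsub k C (tvar j)   = if j ≡ᵇ k then C else tvar j

  tsubL : ℕ → Ty → List Ty → List Ty
  tsubL k C []       = []
  tsubL k C (U ∷ Us) = tsub k C U ∷ tsubL k C Us

data Unf : Ty → Attr → List Ty → Set where
  unf-ch : ∀ {a Us} → Unf (chT a Us) a Us
  unf-mu : ∀ {B a Us} → Unf (tsub 0 (mu B) B) a Us → Unf (mu B) a Us

-- equi-recursive equality: bisimilarity of unfoldings
IsTyBisim : (Ty → Ty → Set) → Set
IsTyBisim R = ∀ U V → R U V →
    (∀ a Us → Unf U a Us → ∃[ Vs ] (Unf V a Vs × Pointwise R Us Vs))
  × (∀ a Vs → Unf V a Vs → ∃[ Us ] (Unf U a Us × Pointwise R Us Vs))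

_~_ : Ty → Ty → Set₁
U ~ V = ∃[ R ] (IsTyBisim R × R U V)

data Type : Set where
  proc : Type
  chan : (U : Ty) → T (ok 0 U) → Type

∧-split : ∀ x y → T (x ∧ y) → T x × T y
∧-split true  y p = tt , p
∧-split false y ()

payload : (Us : List Ty) → T (okL 0 Us) → List Type
payload []       _ = []
payload (U ∷ Us) w = chan U (proj₁ (∧-split (ok 0 U) (okL 0 Us) w))
                   ∷ payload Us (proj₂ (∧-split (ok 0 U) (okL 0 Us) w))

data _≃_ : Type → Type → Set₁ where
  proc≃ : proc ≃ proc
  chan≃ : ∀ {U V w w'} → U ~ V → chan U w ≃ chan V w'

data Split : Type → Type → Type → Set where
  split-ω    : ∀ {Us w} → Split (chan (chT ω Us) w) (chan (chT ω Us) w) (chan (chT ω Us) w)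
  split-proc : Split proc proc proc
  split-bul  : ∀ {i Us w} → Split (chan (chT (bul i) Us) w) (chan (chT one Us) w) (chan (chT (bul (suc i)) Us) w)

data AttrLe₁ : Attr → Attr → Set where
  bul-suc : ∀ {i} → AttrLe₁ (bul i) (bul (suc i))
  bul-ω   : ∀ {i} → AttrLe₁ (bul i) ω
  ω-one   : AttrLe₁ ω one

_⪯ₐ_ : Attr → Attr → Set
_⪯ₐ_ = Star AttrLe₁

data _⪯_ : Type → Type → Set where
  sub : ∀ {a₁ a₂ Us w} → a₁ ⪯ₐ a₂ → chan (chT a₁ Us) w ⪯ chan (chT a₂ Us) w

-- Type environments (finite multisets, represented as lists)

Entry : Set
Entry = Ident × Type

Env : Set
Env = List Entry

infixl 5 _,,_
_,,_ : Env → Entry → Env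
Γ ,, e = Γ ++ (e ∷ [])

_∶∶_ : List Ident → List Type → Env
vs ∶∶ Ts = zip vs Ts

-- decrement of an attribute:  empty (a=1), ω (a=ω), •i (a=•(i+1)); undefined for •
data Decr : Attr → List Attr → Set where
  dec-one : Decr one []
  dec-ω   : Decr ω (ω ∷ [])
  dec-bul : ∀ {i} → Decr (bul (suc i)) (bul i ∷ [])

decEnv : Ident → (Us : List Ty) → T (okL 0 Us) → List Attr → Env
decEnv u Us w []       = []
decEnv u Us w (a ∷ as) = (u , chan (chT a Us) w) ∷ decEnv u Us w as

-- one step of ≺ (multiset equality is handled by the permutation step)
data Prec₁ : Env → Env → Set₁ where
  p-perm  : ∀ {Γ Γ'} → Γ ↭ Γ' → Prec₁ Γ Γ'
  p-split : ∀ {Γ u T T₁ T₂} → Split T T₁ T₂ → Prec₁ (Γ ,, (u , T)) (Γ ,, (u , T₁) ,, (u , T₂))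
  p-join  : ∀ {Γ u T T₁ T₂} → Split T T₁ T₂ → Prec₁ (Γ ,, (u , T₁) ,, (u , T₂)) (Γ ,, (u , T))
  p-eq    : ∀ {Γ u T₁ T₂} → T₁ ≃ T₂ → Prec₁ (Γ ,, (u , T₁)) (Γ ,, (u , T₂))
  p-sub   : ∀ {Γ u T₁ T₂} → T₁ ⪯ T₂ → Prec₁ (Γ ,, (u , T₁)) (Γ ,, (u , T₂))
  p-weak  : ∀ {Γ u T} → Prec₁ (Γ ,, (u , T)) Γ
  p-bul   : ∀ {Γ u Us₁ Us₂ w₁ w₂} →
            Prec₁ (Γ ,, (u , chan (chT (bul 0) Us₁) w₁)) (Γ ,, (u , chan (chT (bul 0) Us₂) w₂))

_≺_ : Env → Env → Set₁
_≺_ = Star Prec₁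

data EntryEq : Entry → Entry → Set₁ where
  entry≃ : ∀ {u T T'} → T ≃ T' → EntryEq (u , T) (u , T')

_≋_ : Env → Env → Set₁
Γ ≋ Γ' = ∃[ Γ'' ] (Γ ↭ Γ'' × Pointwise EntryEq Γ'' Γ')

dom : Env → List Ident
dom = map proj₁

data Unr : Entry → Set where
  unr-proc : ∀ {u} → Unr (u , proc)
  unr-ω    : ∀ {u Us w} → Unr (u , chan (chT ω Us) w)

data _⊢_ : Env → Proc → Set₁ where
  t-send  : ∀ {Γ u vs a as Us w P} → Decr a as → length vs ≡ length Us →
            (Γ ++ decEnv u Us w as) ⊢ P →
            ((Γ ,, (u , chan (chT a Us) w)) ++ (vs ∶∶ payload Us w)) ⊢ send u vs P
  t-recv  : ∀ {Γ u xs a as Us w P} → Decr a as → length xs ≡ length Us →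
            (Γ ++ decEnv u Us w as ++ (map vr xs ∶∶ payload Us w)) ⊢ P →
            (Γ ,, (u , chan (chT a Us) w)) ⊢ recv u xs P
  t-par   : ∀ {Γ₁ Γ₂ P Q} → Γ₁ ⊢ P → Γ₂ ⊢ Q → (Γ₁ ++ Γ₂) ⊢ par P Q
  t-if    : ∀ {Γ u v P Q} → u ∈ dom Γ → v ∈ dom Γ → Γ ⊢ P → Γ ⊢ Q → Γ ⊢ ifte u v P Q
  t-rec   : ∀ {Γ w P} → All Unr Γ → (Γ ,, (vr w , proc)) ⊢ P → Γ ⊢ rec w P
  t-var   : ∀ {w} → ((vr w , proc) ∷ []) ⊢ pvar w
  t-free  : ∀ {Γ u Us w P} → Γ ⊢ P → (Γ ,, (u , chan (chT (bul 0) Us) w)) ⊢ free u P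
  t-alloc : ∀ {Γ x Us w P} → (Γ ,, (vr x , chan (chT (bul 0) Us) w)) ⊢ P → Γ ⊢ alloc x P
  t-nil   : [] ⊢ nil
  t-sub   : ∀ {Γ Γ' P} → Γ ≺ Γ' → Γ' ⊢ P → Γ ⊢ P

Consistent : Env → Set₁
Consistent Γ = ∃[ Γ' ] (Unique (dom Γ') × Γ' ≺ Γ)

-- dom(Γ) ⊆ M  (in particular all identifiers are channels)
DomIn : Env → RM → Set
DomIn Γ M = All (λ e → ∃[ c ] (proj₁ e ≡ ch c × M c ≡ true)) Γ

_⊢S_ : Env → Sys → Set₁
Γ ⊢S (M , P) = Γ ⊢ P × DomIn Γ M × Consistent Γ

Config : Env → Sys → Set₁
Config Γ (M , P) = WfSys (M , P) × DomIn Γ M × ∃[ Δ ] (Consistent (Γ ++ Δ) × Δ ⊢S (M , P))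

data Label : Set where
  out    : Chan → List Chan → Label
  inp    : Chan → List Chan → Label
  τ      : Label
  allocL : Label
  freeL  : Chan → Label
  envL   : Label

plus1 minus1 : ℤ
plus1 = + 1
minus1 = -[1+ 0 ]

-- pre-transitions  Γ ◁ M ▷ P  --μ-->_k  Γ' ◁ M' ▷ P'
-- (input environments are matched, and output environments produced,
--  up to multiset equality with types up to ~)
data Pre : Env → RM → Proc → Label → ℤ → Env → RM → Proc → Set₁ where
  pr-out   : ∀ {Γ Γ₀ Γ' M c ds a as Us w P} → Decr a as → length ds ≡ length Us →
             Γ ≋ (Γ₀ ,, (ch c , chan (chT a Us) w)) →
             Γ' ≋ ((Γ₀ ++ decEnv (ch c) Us w as) ++ (map ch ds ∶∶ payload Us w)) →
             Pre Γ M (send (ch c) (map ch ds) P) (out c ds) (+ 0) Γ' M P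
  pr-inp   : ∀ {Γ Γ₀ Γ' M c ds a as Us w xs P} → Decr a as → length ds ≡ length Us →
             length xs ≡ length ds →
             Γ ≋ ((Γ₀ ,, (ch c , chan (chT a Us) w)) ++ (map ch ds ∶∶ payload Us w)) →
             Γ' ≋ (Γ₀ ++ decEnv (ch c) Us w as) →
             Pre Γ M (recv (ch c) xs P) (inp c ds) (+ 0) Γ' M (substs xs ds P)
  pr-comml : ∀ {Γ Γ₁ Γ₁' Γ₂ Γ₂' M c ds P P' Q Q'} →
             Pre Γ₁ M P (out c ds) (+ 0) Γ₁' M P' → Pre Γ₂ M Q (inp c ds) (+ 0) Γ₂' M Q' →
             Pre Γ M (par P Q) τ (+ 0) Γ M (par P' Q')
  pr-commr : ∀ {Γ Γ₁ Γ₁' Γ₂ Γ₂' M c ds P P' Q Q'} →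
             Pre Γ₁ M P (out c ds) (+ 0) Γ₁' M P' → Pre Γ₂ M Q (inp c ds) (+ 0) Γ₂' M Q' →
             Pre Γ M (par Q P) τ (+ 0) Γ M (par Q' P')
  pr-parl  : ∀ {Γ Γ' M M' P P' Q μ k} →
             Pre Γ M P μ k Γ' M' P' → Pre Γ M (par P Q) μ k Γ' M' (par P' Q)
  pr-parr  : ∀ {Γ Γ' M M' P P' Q μ k} →
             Pre Γ M P μ k Γ' M' P' → Pre Γ M (par Q P) μ k Γ' M' (par Q P')
  pr-env   : ∀ {Γ Γ' M P} → Γ ≺ Γ' → Pre Γ M P envL (+ 0) Γ' M P
  pr-rec   : ∀ {Γ M w P} → Pre Γ M (rec w P) τ (+ 0) Γ M (psubst w (rec w P) P)
  pr-then  : ∀ {Γ M c P Q} → M c ≡ true →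
             Pre Γ M (ifte (ch c) (ch c) P Q) τ (+ 0) Γ M P
  pr-else  : ∀ {Γ M c d P Q} → c ≢ d → M c ≡ true → M d ≡ true →
             Pre Γ M (ifte (ch c) (ch d) P Q) τ (+ 0) Γ M Q
  pr-alloc : ∀ {Γ M c x P} → M c ≡ false →
             Pre Γ M (alloc x P) τ plus1 Γ (addC M c) (substP x c P)
  pr-allocL : ∀ {Γ Γ' M c Us w P} → M c ≡ false →
             Γ' ≋ (Γ ,, (ch c , chan (chT (bul 0) Us) w)) →
             Pre Γ M P allocL plus1 Γ' (addC M c) P
  pr-free  : ∀ {Γ M c P} → M c ≡ true →
             Pre Γ M (free (ch c) P) τ minus1 Γ (remC M c) P
  pr-freeL : ∀ {Γ Γ₀ Γ' M c Us w P} → M c ≡ true →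
             Γ ≋ (Γ₀ ,, (ch c , chan (chT (bul 0) Us) w)) → Γ' ≋ Γ₀ →
             Pre Γ M P (freeL c) minus1 Γ' (remC M c) P

RenamingMod : Env → Set
RenamingMod Γ = Σ (ℕ ↔ ℕ) (λ σ → ∀ c → ch c ∈ dom Γ → Inverse.to σ c ≡ c)

renSys : (ℕ ↔ ℕ) → RM → Proc → Sys
renSys σ M P = (λ c → M (Inverse.from σ c)) , renP (Inverse.to σ) P

Trans : Env → Sys → Label → ℤ → Env → Sys → Set₁
Trans Γ (M , P) μ k Γ' (M' , P') =
  Σ (RenamingMod Γ) (λ σ →
    Pre Γ (proj₁ (renSys (proj₁ σ) M P)) (proj₂ (renSys (proj₁ σ) M P)) μ k Γ' M' P')

data TauStar : Env → Sys → ℤ → Env → Sys → Set₁ where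
  τ-refl : ∀ {Γ S} → TauStar Γ S (+ 0) Γ S
  τ-step : ∀ {Γ Γ' Γ'' S S' S'' k k'} →
           Trans Γ S τ k Γ' S' → TauStar Γ' S' k' Γ'' S'' → TauStar Γ S (k ℤ.+ k') Γ'' S''

Weak : Env → Sys → Label → ℤ → Env → Sys → Set₁
Weak Γ S μ k Γ' S' =
  ∃[ Γ₁ ] ∃[ S₁ ] ∃[ Γ₂ ] ∃[ S₂ ] ∃[ k₁ ] ∃[ k₂ ] ∃[ k₃ ]
    (TauStar Γ S k₁ Γ₁ S₁ × Trans Γ₁ S₁ μ k₂ Γ₂ S₂ × TauStar Γ₂ S₂ k₃ Γ' S'
     × k ≡ k₁ ℤ.+ k₂ ℤ.+ k₃)

WeakHat : Env → Sys → Label → ℤ → Env → Sys → Set₁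
WeakHat Γ S τ k Γ' S'              = TauStar Γ S k Γ' S'
WeakHat Γ S (out c ds) k Γ' S'     = Weak Γ S (out c ds) k Γ' S'
WeakHat Γ S (inp c ds) k Γ' S'     = Weak Γ S (inp c ds) k Γ' S'
WeakHat Γ S allocL k Γ' S'         = Weak Γ S allocL k Γ' S'
WeakHat Γ S (freeL c) k Γ' S'      = Weak Γ S (freeL c) k Γ' S'
WeakHat Γ S envL k Γ' S'           = Weak Γ S envL k Γ' S'

ATRel : Set₂
ATRel = Env → ℕ → Sys → Sys → Set₁

credit : ℕ → ℤ → ℤ → ℤ
credit n l k = (+ n) ℤ.+ l ℤ.- k

IsAmortisedBisim : ATRel → Set₁
IsAmortisedBisim R =
    (∀ {Γ n S T} → R Γ n S T → Config Γ S × Config Γ T)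
  × (∀ {Γ n S T μ k Γ' S'} → R Γ n S T → Trans Γ S μ k Γ' S' →
       ∃[ l ] ∃[ T' ] ∃[ m ] (WeakHat Γ T μ l Γ' T' × + m ≡ credit n l k × R Γ' m S' T'))
  × (∀ {Γ n S T μ l Γ' T'} → R Γ n S T → Trans Γ T μ l Γ' T' →
       ∃[ k ] ∃[ S' ] ∃[ m ] (WeakHat Γ S μ k Γ' S' × + m ≡ credit n l k × R Γ' m S' T'))

_⊨_⊑[_]_ : Env → Sys → ℕ → Sys → Set₂
Γ ⊨ S ⊑[ n ] T = ∃[ R ] (IsAmortisedBisim R × R Γ n S T)

_⊨_⊑_ : Env → Sys → Sys → Set₂
Γ ⊨ S ⊑ T = ∃[ n ] (Γ ⊨ S ⊑[ n ] T)

-- The composite of two amortised typed bisimulations, with credits added,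
-- is again one. When the first relation answers a move by a weak transition
-- of the middle system, the second relation has to answer every step of it;
-- the credit changes telescope, so one step-by-step simulation lifts to weak
-- transitions with the same credit bookkeeping.
module Submission where

open import Defs
import Data.Nat as ℕ
open import Data.Integer using (ℤ; +_; _+_; _-_; _*_; 1ℤ; -1ℤ)
open import Data.Integer.Properties using (+-identityˡ; +-assoc; pos-+)
open import Data.Integer.Tactic.RingSolver using (solve-∀)
open import Data.Product using (∃-syntax; _×_; _,_; proj₁; proj₂)
open import Relation.Binary.PropositionalEquality using (_≡_; refl; sym; trans; cong; cong₂; subst)

tauStar-++ : ∀ {Γ Γ' Γ'' S S' S'' k k'} →
  TauStar Γ S k Γ' S' → TauStar Γ' S' k' Γ'' S'' → TauStar Γ S (k + k') Γ'' S''
tauStar-++ {k' = k'} τ-refl t =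
  subst (λ z → TauStar _ _ z _ _) (sym (+-identityˡ k')) t
tauStar-++ {k' = k''} (τ-step {k = k} {k' = k'} s t) t' =
  subst (λ z → TauStar _ _ z _ _) (sym (+-assoc k k' k'')) (τ-step s (tauStar-++ t t'))

weak-pad : ∀ {Γ Γ₁ Γ₂ Γ' S S₁ S₂ S' μ a b c} →
  TauStar Γ S a Γ₁ S₁ → Weak Γ₁ S₁ μ b Γ₂ S₂ → TauStar Γ₂ S₂ c Γ' S' →
  Weak Γ S μ (a + b + c) Γ' S'
weak-pad {a = a} {c = c} t (_ , _ , _ , _ , k₁ , k₂ , k₃ , t₁ , u , t₂ , refl) t' =
  _ , _ , _ , _ , a + k₁ , k₂ , k₃ + c , tauStar-++ t t₁ , u , tauStar-++ t₂ t' , assoc a k₁ k₂ k₃ c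
  where
  assoc : ∀ a k₁ k₂ k₃ c → a + (k₁ + k₂ + k₃) + c ≡ a + k₁ + k₂ + (k₃ + c)
  assoc = solve-∀

-- One half of an amortised bisimulation: the challenger S moves at cost k, the
-- responder T answers at cost l, and the credit changes by s · (l − k).
-- Forward simulation is the case s = 1; backward simulation, read on the
-- converse relation, is the case s = −1.
AmortisedSim : ℤ → ATRel → Set₁
AmortisedSim s R = ∀ {Γ n S T μ k Γ' S'} → R Γ n S T → Trans Γ S μ k Γ' S' →
  ∃[ l ] ∃[ T' ] ∃[ m ] (WeakHat Γ T μ l Γ' T' × + m ≡ + n + s * (l - k) × R Γ' m S' T')

Converse : ATRel → ATRel
Converse R Γ n S T = R Γ n T S

isAmortisedBisim⇒forwardSim : ∀ {R} → IsAmortisedBisim R → AmortisedSim 1ℤ R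
isAmortisedBisim⇒forwardSim (_ , fwd , _) {n = n} {k = k} r t
  with fwd r t
... | l , T' , m , w , e , r' = l , T' , m , w , trans e (rearrange (+ n) l k) , r'
  where
  rearrange : ∀ n l k → n + l - k ≡ n + 1ℤ * (l - k)
  rearrange = solve-∀

isAmortisedBisim⇒backwardSim : ∀ {R} → IsAmortisedBisim R → AmortisedSim -1ℤ (Converse R)
isAmortisedBisim⇒backwardSim (_ , _ , bwd) {n = n} {k = l} r t
  with bwd r t
... | k , S' , m , w , e , r' = k , S' , m , w , trans e (rearrange (+ n) l k) , r'
  where
  rearrange : ∀ n l k → n + l - k ≡ n + -1ℤ * (k - l)
  rearrange = solve-∀

credit-unchanged : ∀ n s → + n ≡ + n + s * (+ 0 - + 0)
credit-unchanged n s = lemma (+ n) s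
  where
  lemma : ∀ n s → n ≡ n + s * (+ 0 - + 0)
  lemma = solve-∀

credit-chain : ∀ {n m₁ m₂} s l₁ k₁ l₂ k₂ →
  + m₁ ≡ + n + s * (l₁ - k₁) → + m₂ ≡ + m₁ + s * (l₂ - k₂) →
  + m₂ ≡ + n + s * ((l₁ + l₂) - (k₁ + k₂))
credit-chain {n} s l₁ k₁ l₂ k₂ e₁ e₂ =
  trans e₂ (trans (cong (_+ s * (l₂ - k₂)) e₁) (distrib (+ n) s l₁ k₁ l₂ k₂))
  where
  distrib : ∀ n s l₁ k₁ l₂ k₂ →
    n + s * (l₁ - k₁) + s * (l₂ - k₂) ≡ n + s * ((l₁ + l₂) - (k₁ + k₂))
  distrib = solve-∀

module WeakSimulation {s : ℤ} {R : ATRel} (sim : AmortisedSim s R) where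

  tauStar-sim : ∀ {Γ n S T k Γ' S'} → R Γ n S T → TauStar Γ S k Γ' S' →
    ∃[ l ] ∃[ T' ] ∃[ m ] (TauStar Γ T l Γ' T' × + m ≡ + n + s * (l - k) × R Γ' m S' T')
  tauStar-sim {n = n} r τ-refl = + 0 , _ , n , τ-refl , credit-unchanged n s , r
  tauStar-sim r (τ-step {k = k₁} {k' = k₂} t ts) with sim r t
  ... | l₁ , _ , _ , w₁ , e₁ , r₁ with tauStar-sim r₁ ts
  ... | l₂ , T' , m , w₂ , e₂ , r₂ =
    l₁ + l₂ , T' , m , tauStar-++ w₁ w₂ , credit-chain s l₁ k₁ l₂ k₂ e₁ e₂ , r₂

  -- The middle step is answered by a WeakHat transition, which for μ ≠ τ is
  -- definitionally a Weak one; the caller supplies that conversion.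
  weak-sim : ∀ {μ} → (∀ {Γ S k Γ' S'} → WeakHat Γ S μ k Γ' S' → Weak Γ S μ k Γ' S') →
    ∀ {Γ n S T k Γ' S'} → R Γ n S T → Weak Γ S μ k Γ' S' →
    ∃[ l ] ∃[ T' ] ∃[ m ] (Weak Γ T μ l Γ' T' × + m ≡ + n + s * (l - k) × R Γ' m S' T')
  weak-sim hat⇒weak r (_ , _ , _ , _ , k₁ , k₂ , k₃ , t₁ , u , t₂ , refl)
    with tauStar-sim r t₁
  ... | l₁ , _ , _ , w₁ , e₁ , r₁ with sim r₁ u
  ... | l₂ , _ , _ , w₂ , e₂ , r₂ with tauStar-sim r₂ t₂
  ... | l₃ , T' , m , w₃ , e₃ , r₃ =
    l₁ + l₂ + l₃ , T' , m , weak-pad w₁ (hat⇒weak w₂) w₃ ,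
    credit-chain s (l₁ + l₂) (k₁ + k₂) l₃ k₃ (credit-chain s l₁ k₁ l₂ k₂ e₁ e₂) e₃ , r₃

  weakHat-sim : ∀ μ {Γ n S T k Γ' S'} → R Γ n S T → WeakHat Γ S μ k Γ' S' →
    ∃[ l ] ∃[ T' ] ∃[ m ] (WeakHat Γ T μ l Γ' T' × + m ≡ + n + s * (l - k) × R Γ' m S' T')
  weakHat-sim τ          = tauStar-sim
  weakHat-sim (out c ds) = weak-sim (λ w → w)
  weakHat-sim (inp c ds) = weak-sim (λ w → w)
  weakHat-sim allocL     = weak-sim (λ w → w)
  weakHat-sim (freeL c)  = weak-sim (λ w → w)
  weakHat-sim envL       = weak-sim (λ w → w)

Composite : ATRel → ATRel → ATRel
Composite R₁ R₂ Γ n S S'' =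
  ∃[ n₁ ] ∃[ n₂ ] ∃[ S' ] (n ≡ n₁ ℕ.+ n₂ × R₁ Γ n₁ S S' × R₂ Γ n₂ S' S'')

composite-isAmortisedBisim : ∀ {R₁ R₂} →
  IsAmortisedBisim R₁ → IsAmortisedBisim R₂ → IsAmortisedBisim (Composite R₁ R₂)
composite-isAmortisedBisim {R₁} {R₂} b₁@(cfg₁ , fwd₁ , _) b₂@(cfg₂ , _ , bwd₂) =
  configs , forward , backward
  where
  module Fwd₂ = WeakSimulation {1ℤ} (isAmortisedBisim⇒forwardSim b₂)
  module Bwd₁ = WeakSimulation { -1ℤ} (isAmortisedBisim⇒backwardSim b₁)

  configs : ∀ {Γ n S T} → Composite R₁ R₂ Γ n S T → Config Γ S × Config Γ T
  configs (_ , _ , _ , _ , r₁ , r₂) = proj₁ (cfg₁ r₁) , proj₂ (cfg₂ r₂)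

  forward : ∀ {Γ n S T μ k Γ' S'} → Composite R₁ R₂ Γ n S T → Trans Γ S μ k Γ' S' →
    ∃[ l ] ∃[ T' ] ∃[ m ] (WeakHat Γ T μ l Γ' T' × + m ≡ credit n l k × Composite R₁ R₂ Γ' m S' T')
  forward {μ = μ} {k = k} (n₁ , n₂ , _ , refl , r₁ , r₂) t with fwd₁ r₁ t
  ... | l , S'₁ , m₁ , w , e₁ , r₁' with Fwd₂.weakHat-sim μ r₂ w
  ... | l' , T' , m₂ , w' , e₂ , r₂' =
    l' , T' , m₁ ℕ.+ m₂ , w' , credits , (m₁ , m₂ , S'₁ , refl , r₁' , r₂')
    where
    telescope : ∀ n₁ n₂ l l' k → n₁ + l - k + (n₂ + 1ℤ * (l' - l)) ≡ n₁ + n₂ + l' - k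
    telescope = solve-∀

    credits : + (m₁ ℕ.+ m₂) ≡ credit (n₁ ℕ.+ n₂) l' k
    credits = trans (pos-+ m₁ m₂) (trans (cong₂ _+_ e₁ e₂)
      (trans (telescope (+ n₁) (+ n₂) l l' k) (cong (λ z → z + l' - k) (sym (pos-+ n₁ n₂)))))

  backward : ∀ {Γ n S T μ l Γ' T'} → Composite R₁ R₂ Γ n S T → Trans Γ T μ l Γ' T' →
    ∃[ k ] ∃[ S' ] ∃[ m ] (WeakHat Γ S μ k Γ' S' × + m ≡ credit n l k × Composite R₁ R₂ Γ' m S' T')
  backward {μ = μ} {l = l} (n₁ , n₂ , _ , refl , r₁ , r₂) t with bwd₂ r₂ t
  ... | k' , S'₁ , m₂ , w , e₂ , r₂' with Bwd₁.weakHat-sim μ r₁ w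
  ... | k , S' , m₁ , w' , e₁ , r₁' =
    k , S' , m₁ ℕ.+ m₂ , w' , credits , (m₁ , m₂ , S'₁ , refl , r₁' , r₂')
    where
    telescope : ∀ n₁ n₂ l k' k → n₁ + -1ℤ * (k - k') + (n₂ + l - k') ≡ n₁ + n₂ + l - k
    telescope = solve-∀

    credits : + (m₁ ℕ.+ m₂) ≡ credit (n₁ ℕ.+ n₂) l k
    credits = trans (pos-+ m₁ m₂) (trans (cong₂ _+_ e₁ e₂)
      (trans (telescope (+ n₁) (+ n₂) l k' k) (cong (λ z → z + l - k) (sym (pos-+ n₁ n₂)))))

lemma4p12 : (Γ : Env) (S S' S'' : Sys) →
    Γ ⊨ S ⊑ S' → Γ ⊨ S' ⊑ S'' → Γ ⊨ S ⊑ S''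
lemma4p12 Γ S S' S'' (n₁ , R₁ , b₁ , r₁) (n₂ , R₂ , b₂ , r₂) =
  n₁ ℕ.+ n₂ , Composite R₁ R₂ , composite-isAmortisedBisim b₁ b₂ , (n₁ , n₂ , S' , refl , r₁ , r₂)
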